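{- Let $t$ be a positive integer, let $n>t+1$ and let $\mathcal A\in I(n,t)$. Then every generating set $g\in G(\mathcal A)$ is a $t$-intersecting set system, i.e. $|A\cap B|\ge t$ for all $A,B\in g$.
   Context: $S_n$ is the symmetric group on $[n]=\{1,\dots,n\}$; $\mathrm{fix}(\sigma)=\{x:\sigma(x)=x\}$. Two permutations have a cycle in common if that cycle appears in both cycle decompositions (1-cycles count). A family $\mathcal A\subseteq S_n$ is $t$-cycle-intersecting if any two distinct members have at least $t$ cycles in common; $I(n,t)$ is the collection of all such families. For $B\subseteq[n]$, $\mathscr U_p(B)=\{\sigma\in S_n: B\subseteq\mathrm{fix}(\sigma)\}$, and $\mathscr U_p(\mathcal B)=\bigcup_{B\in\mathcal B}\mathscr U_p(B)$. A collection $g$ of subsets of $[n]$ is a generating set for $\mathcal A$ if $g$ contains no set of cardinality $n-1$ and $\mathscr U_p(g)=\mathcal A$; $G(\mathcal A)$ is the set of all generating sets of $\mathcal A$. -}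

module Defs where

open import Data.Nat using (ℕ; zero; suc; _∸_)
open import Data.Fin using (Fin)
open import Data.Fin.Subset using (Subset; _∈_; _⊆_; ∣_∣)
open import Data.Fin.Permutation using (Permutation′; _⟨$⟩ʳ_)
open import Data.Product using (Σ; _×_; ∃)
open import Relation.Binary.PropositionalEquality using (_≡_; _≢_)
open import Relation.Nullary using (¬_)
open import Function.Bundles using (_⇔_)

iter : ∀ {n} → Permutation′ n → ℕ → Fin n → Fin n
iter σ zero    x = x
iter σ (suc k) x = σ ⟨$⟩ʳ (iter σ k x)

SameCycle : ∀ {n} → Permutation′ n → Fin n → Fin n → Set
SameCycle σ x y = ∃ λ k → iter σ k x ≡ y

-- the cycle of σ through x is also a cycle of τ (same elements, same cyclic order):
-- σ^k(x) = τ^k(x) for every k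
CommonCycleAt : ∀ {n} → Permutation′ n → Permutation′ n → Fin n → Set
CommonCycleAt σ τ x = ∀ k → iter σ k x ≡ iter τ k x

-- σ and τ have at least t cycles in common: there are t points lying in
-- pairwise distinct cycles of σ, each of whose cycle is common to σ and τ
HaveTCommonCycles : ∀ {n} → ℕ → Permutation′ n → Permutation′ n → Set
HaveTCommonCycles {n} t σ τ =
  Σ (Fin t → Fin n) λ f →
    (∀ i → CommonCycleAt σ τ (f i)) ×
    (∀ i j → SameCycle σ (f i) (f j) → i ≡ j)

_≈ₚ_ : ∀ {n} → Permutation′ n → Permutation′ n → Set
σ ≈ₚ τ = ∀ x → σ ⟨$⟩ʳ x ≡ τ ⟨$⟩ʳ x

Family : ℕ → Set₁
Family n = Permutation′ n → Set

TCycleIntersecting : ∀ {n} → ℕ → Family n → Set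
TCycleIntersecting t 𝒜 =
  ∀ σ τ → 𝒜 σ → 𝒜 τ → ¬ (σ ≈ₚ τ) → HaveTCommonCycles t σ τ

FixesAll : ∀ {n} → Subset n → Permutation′ n → Set
FixesAll B σ = ∀ x → x ∈ B → σ ⟨$⟩ʳ x ≡ x

Collection : ℕ → Set₁
Collection n = Subset n → Set

Up : ∀ {n} → Collection n → Family n
Up g σ = ∃ λ B → g B × FixesAll B σ

IsGeneratingSet : ∀ {n} → Collection n → Family n → Set
IsGeneratingSet {n} g 𝒜 =
  (∀ B → g B → ∣ B ∣ ≢ n ∸ 1) × (∀ σ → Up g σ ⇔ 𝒜 σ)

module Submission where

-- For a set X in a generating set g, every permutation fixing X
-- pointwise lies in 𝒜.  Since |X| ≠ n-1, the complement of X is not a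
-- single point, so there is a permutation σ that fixes X and permutes the
-- complement of X in ONE cycle ("a full cycle outside X").  Two distinct
-- full cycles σ (outside A) and τ (outside B) can only share cycles through
-- points of A ∩ B: a shared cycle through a moved point is the whole moved
-- part of both, forcing σ = τ.  So the t common cycles given by
-- t-cycle-intersection provide t distinct points of A ∩ B.

open import Defs
open import Data.Nat using (ℕ; _≤_; _<_; _+_)
open import Data.Fin.Subset using (_∩_; ∣_∣)

open import Data.Nat using (zero; suc; _∸_; z≤n; s≤s)
open import Data.Nat.Properties
  using (+-comm; +-cancelˡ-≤; +-monoˡ-≤; m∸n+n≡m; m∸[m∸n]≡n; module ≤-Reasoning)
import Data.Bool.Properties as Bool
open import Data.Fin using (Fin)
import Data.Fin as F
open import Data.Fin.Properties using (suc-injective; injective⇒≤)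
open import Data.Fin.Subset using (Subset; inside; outside; ∁)
  renaming (_∈_ to _∈ₛ_; _∉_ to _∉ₛ_)
open import Data.Fin.Subset.Properties
  using (_∈?_; ⊆-antisym; x∈p∩q⁺; ∩-idem; ∣p∣≤n; ∣∁p∣≡n∸∣p∣; x∈∁p⇒x∉p; x∉p⇒x∈∁p)
open import Data.Fin.Permutation using (Permutation′; _⟨$⟩ʳ_; _∘ₚ_; transpose)
  renaming (id to idₚ)
import Data.Fin.Permutation.Components as Components
open import Data.Vec using ([]; _∷_) renaming (here to hereₛ; there to thereₛ)
open import Data.Vec.Properties using (≡-dec)
open import Data.List using (List; map; length; lookup)
  renaming ([] to []ₗ; _∷_ to _∷ₗ_)
open import Data.List.Properties using (length-map)
open import Data.List.Membership.Propositional using (_∈_; _∉_)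
open import Data.List.Membership.Propositional.Properties using (∈-map⁺; ∈-map⁻)
open import Data.List.Relation.Unary.Any using (here; there; index)
open import Data.List.Relation.Unary.Any.Properties using (lookup-index)
import Data.List.Relation.Unary.All as All
open import Data.List.Relation.Unary.All.Properties using (All¬⇒¬Any; ¬Any⇒All¬)
open import Data.List.Relation.Unary.Unique.Propositional using (Unique; []; _∷_)
import Data.List.Relation.Unary.Unique.Propositional.Properties as Unique
open import Data.Product using (_,_)
open import Data.Empty using (⊥-elim)
open import Relation.Nullary using (¬_; yes; no)
open import Relation.Binary.PropositionalEquality
open import Function using (_∘_)
open import Function.Bundles using (Equivalence)

private
  variable
    n t : ℕ
    σ τ : Permutation′ n
    A B X : Subset n
    x y z : Fin n

-- Iteration and orbits

iter-+ : ∀ (σ : Permutation′ n) j k x → iter σ (j + k) x ≡ iter σ j (iter σ k x)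
iter-+ σ zero    k x = refl
iter-+ σ (suc j) k x = cong (σ ⟨$⟩ʳ_) (iter-+ σ j k x)

iter-fixed : ∀ j → σ ⟨$⟩ʳ x ≡ x → iter σ j x ≡ x
iter-fixed zero    e = refl
iter-fixed {σ = σ} (suc j) e = trans (cong (σ ⟨$⟩ʳ_) (iter-fixed j e)) e

sameCycle-trans : SameCycle σ x y → SameCycle σ y z → SameCycle σ x z
sameCycle-trans {σ = σ} {x} {y} {z} (j , p) (k , q) = k + j , (begin
  iter σ (k + j) x      ≡⟨ iter-+ σ k j x ⟩
  iter σ k (iter σ j x) ≡⟨ cong (iter σ k) p ⟩
  iter σ k y            ≡⟨ q ⟩
  z                     ∎)
  where open ≡-Reasoning

fixed-point-alone : σ ⟨$⟩ʳ x ≡ x → SameCycle σ x z → x ≡ z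
fixed-point-alone e (j , p) = trans (sym (iter-fixed j e)) p

common-cycle-agree : CommonCycleAt σ τ x → SameCycle σ x y → σ ⟨$⟩ʳ y ≡ τ ⟨$⟩ʳ y
common-cycle-agree {σ = σ} {τ} {x} {y} common (j , p) = begin
  σ ⟨$⟩ʳ y          ≡⟨ cong (σ ⟨$⟩ʳ_) (sym p) ⟩
  iter σ (suc j) x  ≡⟨ common (suc j) ⟩
  τ ⟨$⟩ʳ iter τ j x ≡⟨ cong (τ ⟨$⟩ʳ_) (trans (sym (common j)) p) ⟩
  τ ⟨$⟩ʳ y          ∎
  where open ≡-Reasoning

common-cycle-orbit : CommonCycleAt σ τ x → SameCycle τ x y → SameCycle σ x y
common-cycle-orbit common (j , p) = j , trans (common j) p

-- Full cycles outside a set and their common cycles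

record FullCycleOutside (X : Subset n) (σ : Permutation′ n) : Set where
  field
    fixes    : FixesAll X σ
    moves    : ∀ y → y ∉ₛ X → σ ⟨$⟩ʳ y ≢ y
    connects : ∀ x y → x ∉ₛ X → y ∉ₛ X → SameCycle σ x y
open FullCycleOutside

fixed⇒∈ : FullCycleOutside X σ → σ ⟨$⟩ʳ y ≡ y → y ∈ₛ X
fixed⇒∈ {X = X} {y = y} full e with y ∈? X
... | yes y∈X = y∈X
... | no  y∉X = ⊥-elim (moves full y y∉X e)

fixed-set-unique : FullCycleOutside A σ → FullCycleOutside B τ → σ ≈ₚ τ → A ≡ B
fixed-set-unique fullσ fullτ σ≈τ = ⊆-antisym
  (λ {y} y∈A → fixed⇒∈ fullτ (trans (sym (σ≈τ y)) (fixes fullσ y y∈A)))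
  (λ {y} y∈B → fixed⇒∈ fullσ (trans (σ≈τ y) (fixes fullτ y y∈B)))

common-cycle-moved : FullCycleOutside A σ → FullCycleOutside B τ →
  CommonCycleAt σ τ x → x ∉ₛ A → x ∉ₛ B
common-cycle-moved {x = x} fullσ fullτ common x∉A x∈B =
  moves fullσ x x∉A (trans (common-cycle-agree common (0 , refl)) (fixes fullτ x x∈B))

-- If two full cycles share the cycle through a point that σ moves, that
-- cycle is the whole moved part of both, so they coincide.
shared-moved-cycle⇒≈ : FullCycleOutside A σ → FullCycleOutside B τ →
  CommonCycleAt σ τ x → x ∉ₛ A → σ ≈ₚ τ
shared-moved-cycle⇒≈ {A = A} {B = B} {x = x} fullσ fullτ common x∉A y
  with y ∈? A | y ∈? B
... | no y∉A  | _       = common-cycle-agree common (connects fullσ x y x∉A y∉A)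
... | yes y∈A | yes y∈B = trans (fixes fullσ y y∈A) (sym (fixes fullτ y y∈B))
... | yes _   | no  y∉B = common-cycle-agree common (common-cycle-orbit common
  (connects fullτ x y (common-cycle-moved fullσ fullτ common x∉A) y∉B))

common-point∈ : FullCycleOutside A σ → FullCycleOutside B τ → ¬ σ ≈ₚ τ →
  CommonCycleAt σ τ x → x ∈ₛ A
common-point∈ {A = A} {x = x} fullσ fullτ σ≉τ common with x ∈? A
... | yes x∈A = x∈A
... | no  x∉A = ⊥-elim (σ≉τ (shared-moved-cycle⇒≈ fullσ fullτ common x∉A))

common-point∈∩ : FullCycleOutside A σ → FullCycleOutside B τ → ¬ σ ≈ₚ τ →
  CommonCycleAt σ τ x → x ∈ₛ A ∩ B
common-point∈∩ fullσ fullτ σ≉τ common = x∈p∩q⁺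
  ( common-point∈ fullσ fullτ σ≉τ common
  , common-point∈ fullτ fullσ (σ≉τ ∘ λ τ≈σ y → sym (τ≈σ y)) (λ k → sym (common k)))

-- Counting points of a subset

elements : Subset n → List (Fin n)
elements []            = []ₗ
elements (inside ∷ p)  = F.zero ∷ₗ map F.suc (elements p)
elements (outside ∷ p) = map F.suc (elements p)

∈-elements⁺ : ∀ {p : Subset n} → x ∈ₛ p → x ∈ elements p
∈-elements⁺ hereₛ                          = here refl
∈-elements⁺ {p = inside ∷ p}  (thereₛ x∈p) = there (∈-map⁺ F.suc (∈-elements⁺ x∈p))
∈-elements⁺ {p = outside ∷ p} (thereₛ x∈p) = ∈-map⁺ F.suc (∈-elements⁺ x∈p)

∈-elements⁻ : ∀ {p : Subset n} → x ∈ elements p → x ∈ₛ p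
∈-elements⁻ {p = inside ∷ p} (here refl) = hereₛ
∈-elements⁻ {p = inside ∷ p} (there x∈) with ∈-map⁻ F.suc x∈
... | _ , y∈ , refl = thereₛ (∈-elements⁻ y∈)
∈-elements⁻ {p = outside ∷ p} x∈ with ∈-map⁻ F.suc x∈
... | _ , y∈ , refl = thereₛ (∈-elements⁻ y∈)

length-elements : ∀ (p : Subset n) → length (elements p) ≡ ∣ p ∣
length-elements []            = refl
length-elements (inside ∷ p)  = cong suc (trans (length-map F.suc (elements p)) (length-elements p))
length-elements (outside ∷ p) = trans (length-map F.suc (elements p)) (length-elements p)

elements-unique : ∀ (p : Subset n) → Unique (elements p)
elements-unique []            = []
elements-unique (inside ∷ p)  =
  ¬Any⇒All¬ _ zero∉ ∷ Unique.map⁺ suc-injective (elements-unique p)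
  where
  zero∉ : F.zero ∉ map F.suc (elements p)
  zero∉ z∈ with ∈-map⁻ F.suc z∈
  ... | _ , _ , ()
elements-unique (outside ∷ p) = Unique.map⁺ suc-injective (elements-unique p)

-- t distinct points of P show t ≤ |P|: their positions in the list of
-- elements of P form an injection Fin t → Fin |P|.
injection-bound : ∀ {P : Subset n} (h : Fin t → Fin n) →
  (∀ i j → h i ≡ h j → i ≡ j) → (∀ i → h i ∈ₛ P) → t ≤ ∣ P ∣
injection-bound {t = t} {P = P} h h-injective h∈P =
  subst (t ≤_) (length-elements P) (injective⇒≤ position-injective)
  where
  position : Fin t → Fin (length (elements P))
  position i = index (∈-elements⁺ (h∈P i))

  position-injective : ∀ {i j} → position i ≡ position j → i ≡ j
  position-injective {i} {j} e = h-injective i j (begin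
    h i                              ≡⟨ lookup-index (∈-elements⁺ (h∈P i)) ⟩
    lookup (elements P) (position i) ≡⟨ cong (lookup (elements P)) e ⟩
    lookup (elements P) (position j) ≡⟨ sym (lookup-index (∈-elements⁺ (h∈P j))) ⟩
    h j                              ∎)
    where open ≡-Reasoning

full-cycles-bound : ∀ {𝒜 : Family n} → TCycleIntersecting t 𝒜 → 𝒜 σ → 𝒜 τ →
  FullCycleOutside A σ → FullCycleOutside B τ → ¬ σ ≈ₚ τ → t ≤ ∣ A ∩ B ∣
full-cycles-bound intersecting σ∈𝒜 τ∈𝒜 fullσ fullτ σ≉τ
  with intersecting _ _ σ∈𝒜 τ∈𝒜 σ≉τ
... | f , common , separated = injection-bound f
  (λ i j e → separated i j (0 , e))
  (λ i → common-point∈∩ fullσ fullτ σ≉τ (common i))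

-- Full cycles built from lists

transpose-fixes : ∀ {a b y : Fin n} → a ≢ y → b ≢ y → Components.transpose a b y ≡ y
transpose-fixes {a = a} {b} {y} a≢y b≢y with y F.≟ a
... | yes y≡a = ⊥-elim (a≢y (sym y≡a))
... | no _ with y F.≟ b
...   | yes y≡b = ⊥-elim (b≢y (sym y≡b))
...   | no _    = refl

transpose-left : ∀ (a b : Fin n) → Components.transpose a b a ≡ b
transpose-left a b with a F.≟ a
... | yes _   = refl
... | no  a≢a = ⊥-elim (a≢a refl)

transpose-right : ∀ (a b : Fin n) → Components.transpose a b b ≡ a
transpose-right a b with b F.≟ a
... | yes b≡a = b≡a
... | no _ with b F.≟ b
...   | yes _   = refl
...   | no  b≢b = ⊥-elim (b≢b refl)

-- The cycle a₀ ↦ a₁ ↦ ⋯ ↦ aₖ ↦ a₀, as a product of transpositions: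
-- cycle (a ∷ b ∷ r) first applies cycle (b ∷ r), then swaps a and b.
cycle : List (Fin n) → Permutation′ n
cycle []ₗ           = idₚ
cycle (a ∷ₗ []ₗ)    = idₚ
cycle (a ∷ₗ b ∷ₗ r) = cycle (b ∷ₗ r) ∘ₚ transpose a b

cycle-fixes : ∀ (xs : List (Fin n)) → y ∉ xs → cycle xs ⟨$⟩ʳ y ≡ y
cycle-fixes []ₗ           y∉ = refl
cycle-fixes (a ∷ₗ []ₗ)    y∉ = refl
cycle-fixes (a ∷ₗ b ∷ₗ r) y∉ = trans
  (cong (Components.transpose a b) (cycle-fixes (b ∷ₗ r) (y∉ ∘ there)))
  (transpose-fixes (λ a≡y → y∉ (here (sym a≡y))) (λ b≡y → y∉ (there (here (sym b≡y)))))

final : Fin n → List (Fin n) → Fin n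
final u []ₗ      = u
final u (v ∷ₗ r) = final v r

cycle-closes : ∀ (u v : Fin n) r → cycle (u ∷ₗ v ∷ₗ r) ⟨$⟩ʳ final v r ≡ u
cycle-closes u v []ₗ      = transpose-right u v
cycle-closes u v (w ∷ₗ r) =
  trans (cong (Components.transpose u v) (cycle-closes v w r)) (transpose-right u v)

data Path (σ : Permutation′ n) : List (Fin n) → Set where
  end  : ∀ {u} → Path σ (u ∷ₗ []ₗ)
  step : ∀ {u v r} → σ ⟨$⟩ʳ u ≡ v → Path σ (v ∷ₗ r) → Path σ (u ∷ₗ v ∷ₗ r)

path-transport : ∀ {ρ : Permutation′ n} (h : Fin n → Fin n) →
  (∀ y → σ ⟨$⟩ʳ y ≡ h (ρ ⟨$⟩ʳ y)) →
  ∀ {w s} → Path ρ (w ∷ₗ s) → (∀ {y} → y ∈ s → h y ≡ y) → Path σ (w ∷ₗ s)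
path-transport h σ≡h∘ρ end           h-fixes = end
path-transport h σ≡h∘ρ (step e path) h-fixes = step
  (trans (σ≡h∘ρ _) (trans (cong h e) (h-fixes (here refl))))
  (path-transport h σ≡h∘ρ path (h-fixes ∘ there))

cycle-path : ∀ {u : Fin n} {r} → Unique (u ∷ₗ r) → Path (cycle (u ∷ₗ r)) (u ∷ₗ r)
cycle-path {r = []ₗ} _ = end
cycle-path {u = u} {v ∷ₗ r} (u≢ ∷ unique@(v≢ ∷ _)) = step u↦v
  (path-transport (Components.transpose u v) (λ _ → refl) (cycle-path unique)
    (λ y∈r → transpose-fixes (All.lookup u≢ (there y∈r)) (All.lookup v≢ y∈r)))
  where
  u↦v : cycle (u ∷ₗ v ∷ₗ r) ⟨$⟩ʳ u ≡ v
  u↦v = trans (cong (Components.transpose u v) (cycle-fixes (v ∷ₗ r) (All¬⇒¬Any u≢)))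
              (transpose-left u v)

path-from-head : ∀ {u} {r} → Path σ (u ∷ₗ r) → z ∈ (u ∷ₗ r) → SameCycle σ u z
path-from-head path             (here refl) = 0 , refl
path-from-head (step u↦v path) (there z∈)  =
  sameCycle-trans (1 , u↦v) (path-from-head path z∈)

path-to-final : ∀ {u} {r} → Path σ (u ∷ₗ r) → x ∈ (u ∷ₗ r) → SameCycle σ x (final u r)
path-to-final end             (here refl) = 0 , refl
path-to-final (step u↦v path) (here refl) =
  sameCycle-trans (1 , u↦v) (path-to-final path (here refl))
path-to-final (step _ path)   (there x∈)  = path-to-final path x∈

closed-path-connected : ∀ {u} {r} → Path σ (u ∷ₗ r) → σ ⟨$⟩ʳ final u r ≡ u →
  x ∈ (u ∷ₗ r) → z ∈ (u ∷ₗ r) → SameCycle σ x z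
closed-path-connected path closes x∈ z∈ = sameCycle-trans (path-to-final path x∈)
  (sameCycle-trans (1 , closes) (path-from-head path z∈))

cycle-connected : ∀ {xs : List (Fin n)} → Unique xs → length xs ≢ 1 →
  x ∈ xs → z ∈ xs → SameCycle (cycle xs) x z
cycle-connected {xs = []ₗ}         _      _        ()
cycle-connected {xs = a ∷ₗ []ₗ}    _      length≢1 _ = ⊥-elim (length≢1 refl)
cycle-connected {xs = u ∷ₗ v ∷ₗ r} unique _        x∈ z∈ =
  closed-path-connected (cycle-path unique) (cycle-closes u v r) x∈ z∈

cycle-moves : ∀ {xs : List (Fin n)} → Unique xs → length xs ≢ 1 →
  y ∈ xs → cycle xs ⟨$⟩ʳ y ≢ y
cycle-moves {xs = []ₗ}         _      _        ()
cycle-moves {xs = a ∷ₗ []ₗ}    _      length≢1 _ = ⊥-elim (length≢1 refl)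
cycle-moves {y = y} {xs = u ∷ₗ v ∷ₗ r} unique@((u≢v All.∷ _) ∷ _) length≢1 y∈ fixed =
  u≢v (trans (sym (alone (here refl))) (alone (there (here refl))))
  where
  alone : ∀ {z} → z ∈ (u ∷ₗ v ∷ₗ r) → y ≡ z
  alone z∈ = fixed-point-alone fixed (cycle-connected unique length≢1 y∈ z∈)

cycle-full : ∀ {xs : List (Fin n)} → Unique xs → length xs ≢ 1 →
  (∀ {y} → y ∈ xs → y ∉ₛ X) → (∀ {y} → y ∉ₛ X → y ∈ xs) →
  FullCycleOutside X (cycle xs)
cycle-full {xs = xs} unique length≢1 listed⇒∉ ∉⇒listed = record
  { fixes    = λ y y∈X → cycle-fixes xs (λ y∈ → listed⇒∉ y∈ y∈X)
  ; moves    = λ y y∉X → cycle-moves unique length≢1 (∉⇒listed y∉X)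
  ; connects = λ x z x∉X z∉X →
      cycle-connected unique length≢1 (∉⇒listed x∉X) (∉⇒listed z∉X)
  }

missing : Subset n → List (Fin n)
missing X = elements (∁ X)

missing⇒∉ : y ∈ missing X → y ∉ₛ X
missing⇒∉ = x∈∁p⇒x∉p ∘ ∈-elements⁻

∉⇒missing : y ∉ₛ X → y ∈ missing X
∉⇒missing = ∈-elements⁺ ∘ x∉p⇒x∈∁p

length-missing : ∀ (X : Subset n) → length (missing X) ≡ n ∸ ∣ X ∣
length-missing X = trans (length-elements (∁ X)) (∣∁p∣≡n∸∣p∣ X)

missing-full : ∀ (X : Subset n) → ∣ X ∣ ≢ n ∸ 1 → FullCycleOutside X (cycle (missing X))
missing-full {n = n} X ∣X∣≢n-1 = cycle-full (elements-unique (∁ X)) length≢1 missing⇒∉ ∉⇒missing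
  where
  length≢1 : length (missing X) ≢ 1
  length≢1 length≡1 = ∣X∣≢n-1 (begin
    ∣ X ∣             ≡⟨ sym (m∸[m∸n]≡n (∣p∣≤n X)) ⟩
    n ∸ (n ∸ ∣ X ∣)   ≡⟨ cong (n ∸_) (trans (sym (length-missing X)) length≡1) ⟩
    n ∸ 1             ∎)
    where open ≡-Reasoning

swap-∈ : ∀ {a b : Fin n} {s} → y ∈ (a ∷ₗ b ∷ₗ s) → y ∈ (b ∷ₗ a ∷ₗ s)
swap-∈ (here e)           = there (here e)
swap-∈ (there (here e))   = here e
swap-∈ (there (there y∈)) = there (there y∈)

swap-unique : ∀ {a b : Fin n} {s} → Unique (a ∷ₗ b ∷ₗ s) → Unique (b ∷ₗ a ∷ₗ s)
swap-unique ((a≢b All.∷ a≢s) ∷ b≢s ∷ unique) =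
  ((a≢b ∘ sym) All.∷ b≢s) ∷ a≢s ∷ unique

-- On three or more points, the cycles (a b c …) and (b a c …) differ:
-- the first sends a to b, the second sends a to c.
distinct-rotations : ∀ {a b c : Fin n} {r} → Unique (a ∷ₗ b ∷ₗ c ∷ₗ r) →
  ¬ cycle (a ∷ₗ b ∷ₗ c ∷ₗ r) ≈ₚ cycle (b ∷ₗ a ∷ₗ c ∷ₗ r)
distinct-rotations {a = a} unique@(_ ∷ (b≢c All.∷ _) ∷ _) σ≈τ
  with cycle-path unique | cycle-path (swap-unique unique)
... | step a↦b _ | step _ (step a↦c _) = b≢c (trans (sym a↦b) (trans (σ≈τ a) a↦c))

few-missing-bound : ∀ (A : Subset n) → 2 + t ≤ n → n ∸ ∣ A ∣ ≤ 2 → t ≤ ∣ A ∩ A ∣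
few-missing-bound {n = n} {t = t} A 2+t≤n n∸∣A∣≤2 =
  subst (λ P → t ≤ ∣ P ∣) (sym (∩-idem A)) (+-cancelˡ-≤ 2 t ∣ A ∣ (begin
    2 + t                 ≤⟨ 2+t≤n ⟩
    n                     ≡⟨ sym (m∸n+n≡m (∣p∣≤n A)) ⟩
    n ∸ ∣ A ∣ + ∣ A ∣     ≤⟨ +-monoˡ-≤ ∣ A ∣ n∸∣A∣≤2 ⟩
    2 + ∣ A ∣             ∎))
  where open ≤-Reasoning

-- The case A = B: if 𝒜 contains every permutation fixing A, then t ≤ |A|,
-- using two different cyclic orders of the points outside A (listed by xs).
self-intersection-bound : ∀ {𝒜 : Family n} → 2 + t ≤ n → TCycleIntersecting t 𝒜 →
  (∀ σ → FixesAll A σ → 𝒜 σ) →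
  ∀ (xs : List (Fin n)) → Unique xs → (∀ {y} → y ∈ xs → y ∉ₛ A) →
  (∀ {y} → y ∉ₛ A → y ∈ xs) → length xs ≡ n ∸ ∣ A ∣ → t ≤ ∣ A ∩ A ∣
self-intersection-bound {A = A} 2+t≤n _ _ []ₗ _ _ _ length≡ =
  few-missing-bound A 2+t≤n (subst (_≤ 2) length≡ z≤n)
self-intersection-bound {A = A} 2+t≤n _ _ (_ ∷ₗ []ₗ) _ _ _ length≡ =
  few-missing-bound A 2+t≤n (subst (_≤ 2) length≡ (s≤s z≤n))
self-intersection-bound {A = A} 2+t≤n _ _ (_ ∷ₗ _ ∷ₗ []ₗ) _ _ _ length≡ =
  few-missing-bound A 2+t≤n (subst (_≤ 2) length≡ (s≤s (s≤s z≤n)))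
self-intersection-bound {A = A} _ intersecting fixing⇒∈𝒜 (a ∷ₗ b ∷ₗ c ∷ₗ r)
  unique listed⇒∉ ∉⇒listed _ =
  full-cycles-bound intersecting (fixing⇒∈𝒜 _ (fixes fullσ)) (fixing⇒∈𝒜 _ (fixes fullτ))
    fullσ fullτ (distinct-rotations unique)
  where
  fullσ : FullCycleOutside A (cycle (a ∷ₗ b ∷ₗ c ∷ₗ r))
  fullσ = cycle-full unique (λ ()) listed⇒∉ ∉⇒listed
  fullτ : FullCycleOutside A (cycle (b ∷ₗ a ∷ₗ c ∷ₗ r))
  fullτ = cycle-full (swap-unique unique) (λ ()) (listed⇒∉ ∘ swap-∈) (swap-∈ ∘ ∉⇒listed)

generated : ∀ {𝒜 : Family n} {g : Collection n} → IsGeneratingSet g 𝒜 →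
  g X → ∀ σ → FixesAll X σ → 𝒜 σ
generated {X = X} (_ , generates) X∈g σ σ-fixes =
  Equivalence.to (generates σ) (X , X∈g , σ-fixes)

lemma2p10 : (t n : ℕ) → 1 ≤ t → t + 1 < n →
    (𝒜 : Family n) → TCycleIntersecting t 𝒜 →
    (g : Collection n) → IsGeneratingSet g 𝒜 →
    ∀ A B → g A → g B → t ≤ ∣ A ∩ B ∣
lemma2p10 t n _ t+1<n 𝒜 intersecting g generating@(no-co-singleton , _) A B A∈g B∈g
  with ≡-dec Bool._≟_ A B
... | no A≢B =
  full-cycles-bound intersecting (generated generating A∈g _ (fixes fullA))
    (generated generating B∈g _ (fixes fullB)) fullA fullB
    (A≢B ∘ fixed-set-unique fullA fullB)
  where
  fullA : FullCycleOutside A (cycle (missing A))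
  fullA = missing-full A (no-co-singleton A A∈g)
  fullB : FullCycleOutside B (cycle (missing B))
  fullB = missing-full B (no-co-singleton B B∈g)
... | yes refl =
  self-intersection-bound 2+t≤n intersecting (generated generating A∈g) (missing A)
    (elements-unique (∁ A)) missing⇒∉ ∉⇒missing (length-missing A)
  where
  2+t≤n : 2 + t ≤ n
  2+t≤n = subst (λ k → suc k ≤ n) (+-comm t 1) t+1<n
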